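{- Let $T$ be the free model monad of an algebraic theory that has a binary operation $\diamond$. Then the natural transformation $\zeta:TD\to DT$ induced by parallel lifting (i.e. such that for every $T$-model $X$ the $T$-algebra structure on $DX$ induced by $\zeta$ interprets $\diamond$ as the parallel lifting $\diamond^{\mathsf{par}}$) is not a distributive law: it fails the multiplication axiom $\zeta\circ T\mu^D=\mu^D T\circ D\zeta\circ \zeta D$.
   Context: $D$ is the coinductive delay monad: $DX$ is the final coalgebra $DX\simeq X+DX$ with $\mathsf{now}:X\to DX$, $\mathsf{step}:DX\to DX$, unit $\mathsf{now}$ and multiplication $\mu^D$ given by $\mu^D(\mathsf{now}\,x)=x$, $\mu^D(\mathsf{step}\,x)=\mathsf{step}(\mu^D x)$. (In the paper $DX=\forall\kappa.D^\kappa X$ in Clocked Cubical Type Theory, with $D^\kappa X\simeq X+\triangleright^\kappa D^\kappa X$.) For a $T$-model $X$ and an $n$-ary operation $\diamond$, the parallel lifting $\diamond^{\mathsf{par}}:(DX)^n\to DX$ is defined corecursively: $\diamond^{\mathsf{par}}(\mathsf{now}\,x_1,\dots,\mathsf{now}\,x_n)=\mathsf{now}(\diamond_X(x_1,\dots,x_n))$, and if some argument is of the form $\mathsf{step}(\cdot)$ then $\diamond^{\mathsf{par}}(x_1,\dots,x_n)=\mathsf{step}(\diamond^{\mathsf{par}}(x_1',\dots,x_n'))$, where $x_i'=x_i$ if $x_i=\mathsf{now}(\cdot)$ and $x_i'=z$ if $x_i=\mathsf{step}(z)$. A distributive law of $T$ over $D$ is a natural transformation $\zeta:TD\to DT$ satisfying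 $\zeta\circ\eta^T D=D\eta^T$, $\zeta\circ T\eta^D=\eta^D T$, $\zeta\circ\mu^T D=D\mu^T\circ\zeta T\circ T\zeta$, and $\zeta\circ T\mu^D=\mu^D T\circ D\zeta\circ\zeta D$. -}

module Defs where

open import Data.Nat using (ℕ; zero; suc)
open import Data.Fin using (Fin; zero; suc)
open import Data.Sum using (_⊎_; inj₁; inj₂)
open import Data.Maybe using (Maybe; just; nothing)
open import Data.Maybe.Relation.Binary.Pointwise using (Pointwise)
open import Relation.Binary.PropositionalEquality using (_≡_; refl)

Mono : {X : Set} → (ℕ → Maybe X) → Set
Mono {X} s = ∀ n (x : X) → s n ≡ just x → s (suc n) ≡ just x

record Delay (X : Set) : Set where
  constructor delay
  field
    seq  : ℕ → Maybe X
    mono : Mono seq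

open Delay public

now : {X : Set} → X → Delay X
now x = delay (λ _ → just x) (λ _ _ eq → eq)

step : {X : Set} → Delay X → Delay X
step {X} d = delay s m
  where
  s : ℕ → Maybe X
  s zero    = nothing
  s (suc n) = seq d n
  m : Mono s
  m zero    x ()
  m (suc n) x eq = mono d n x eq

out : {X : Set} → Delay X → X ⊎ Delay X
out {X} d with seq d zero
... | just x  = inj₁ x
... | nothing = inj₂ (delay (λ n → seq d (suc n)) (λ n → mono d (suc n)))

module _ {X S : Set} (c : S → X ⊎ S) where
  unfoldSeq : S → ℕ → Maybe X
  unfoldSeq s zero with c s
  ... | inj₁ x = just x
  ... | inj₂ _ = nothing
  unfoldSeq s (suc k) with c s
  ... | inj₁ x  = just x
  ... | inj₂ s' = unfoldSeq s' k

  unfoldMono : (s : S) → Mono (unfoldSeq s)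
  unfoldMono s zero x eq with c s
  ... | inj₁ y  = eq
  unfoldMono s zero x () | inj₂ _
  unfoldMono s (suc k) x eq with c s
  ... | inj₁ y  = eq
  ... | inj₂ s' = unfoldMono s' k x eq

  unfold : S → Delay X
  unfold s = delay (unfoldSeq s) (unfoldMono s)

mapD : {X Y : Set} → (X → Y) → Delay X → Delay Y
mapD {X} {Y} f = unfold c
  where
  c : Delay X → Y ⊎ Delay X
  c d with out d
  ... | inj₁ x  = inj₁ (f x)
  ... | inj₂ d' = inj₂ d'

-- multiplication μ^D :  μ(now x) = x,  μ(step x) = step (μ x)
μD : {X : Set} → Delay (Delay X) → Delay X
μD {X} dd = unfold c (inj₁ dd)
  where
  c : Delay (Delay X) ⊎ Delay X → X ⊎ (Delay (Delay X) ⊎ Delay X)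
  c (inj₂ e) with out e
  ... | inj₁ x  = inj₁ x
  ... | inj₂ e' = inj₂ (inj₂ e')
  c (inj₁ dd) with out dd
  ... | inj₂ dd' = inj₂ (inj₁ dd')
  ... | inj₁ e with out e
  ...   | inj₁ x  = inj₁ x
  ...   | inj₂ e' = inj₂ (inj₂ e')

Bisim : {X : Set} → (X → X → Set) → Delay X → Delay X → Set
Bisim R d e = ∀ n → Pointwise R (seq d n) (seq e n)

allNow : {X : Set} (n : ℕ) → (Fin n → Delay X) → Maybe (Fin n → X)
allNow zero    xs = just (λ ())
allNow (suc n) xs with out (xs zero) | allNow n (λ i → xs (suc i))
... | inj₁ a | just as = just λ { zero → a ; (suc i) → as i }
... | inj₁ a | nothing = nothing
... | inj₂ _ | _       = nothing

-- x' = x if x = now(·),  x' = z if x = step z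
strip : {X : Set} → Delay X → Delay X
strip d with out d
... | inj₁ _  = d
... | inj₂ z  = z

-- ◇^par(now x₁,…,now xₙ) = now (◇(x₁,…,xₙ));
-- otherwise ◇^par(x₁,…,xₙ) = step (◇^par(x₁',…,xₙ'))
par : {X : Set} (n : ℕ) → ((Fin n → X) → X) → (Fin n → Delay X) → Delay X
par {X} n g = unfold c
  where
  c : (Fin n → Delay X) → X ⊎ (Fin n → Delay X)
  c xs with allNow n xs
  ... | just as = inj₁ (g as)
  ... | nothing = inj₂ (λ i → strip (xs i))

-- Algebraic theories (finitary signature + equations) and the free model
-- monad T, presented as terms modulo provable equality (a setoid).

record Signature : Set₁ where
  field
    Op : Set
    ar : Op → ℕ

module _ (Σg : Signature) where
  open Signature Σg

  data Term (X : Set) : Set where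
    var : X → Term X
    op  : (f : Op) → (Fin (ar f) → Term X) → Term X

module _ {Σg : Signature} where
  open Signature Σg

  -- Kleisli extension / substitution (μ^T is bindT t id)
  bindT : {X Y : Set} → Term Σg X → (X → Term Σg Y) → Term Σg Y
  bindT (var x)   σ = σ x
  bindT (op f ts) σ = op f (λ i → bindT (ts i) σ)

  mapT : {X Y : Set} → (X → Y) → Term Σg X → Term Σg Y
  mapT f t = bindT t (λ x → var (f x))

record Theory : Set₁ where
  field
    sig : Signature
    Eqn : Set
    ctx : Eqn → ℕ
    lhs : (e : Eqn) → Term sig (Fin (ctx e))
    rhs : (e : Eqn) → Term sig (Fin (ctx e))

module _ (Th : Theory) where
  open Theory Th
  open Signature sig

  data _⊢_≈_ {X : Set} : Term sig X → Term sig X → Set where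
    ≈-refl  : ∀ {t} → _⊢_≈_ t t
    ≈-sym   : ∀ {t u} → _⊢_≈_ t u → _⊢_≈_ u t
    ≈-trans : ∀ {t u v} → _⊢_≈_ t u → _⊢_≈_ u v → _⊢_≈_ t v
    ≈-cong  : ∀ f {ts us : Fin (ar f) → Term sig X}
            → (∀ i → _⊢_≈_ (ts i) (us i)) → _⊢_≈_ (op f ts) (op f us)
    ≈-ax    : ∀ e (σ : Fin (ctx e) → Term sig X)
            → _⊢_≈_ (bindT (lhs e) σ) (bindT (rhs e) σ)

  -- ζ : T D → D T induced by parallel lifting: the T-algebra morphism
  -- from the free model T(D X) into D(T X), where D(T X) carries the
  -- structure interpreting every operation f by the parallel lifting of
  -- f in the free model T X, and which extends D η^T on generators.
  ζ : {X : Set} → Term sig (Delay X) → Delay (Term sig X)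
  ζ (var d)   = mapD var d
  ζ (op f ts) = par (ar f) (op f) (λ i → ζ (ts i))

-- Instantiate the multiplication axiom at ◇(a, b) with a = now (step x) and
-- b = step (now x), so that μ^D a = μ^D b = step x.  On the left, ζ sees
-- ◇^par(step x, step x), which finishes after one step.  On the right, ζ
-- first sees ◇^par(now (step x), step (now x)), which needs one step to
-- produce ◇(step x, now x); the inner ζ then needs a second step, so
-- μ^D ∘ Dζ ∘ ζ finishes only after two steps.  Termination time is
-- preserved by bisimilarity whatever the equations of the theory are.
module Submission where

open import Defs
open import Data.Nat using (ℕ; zero; suc)
open import Data.Fin using (Fin; zero; suc; _≟_)
open import Data.Fin.Properties using (0≢1+n)
open import Data.Unit using (⊤; tt)
open import Data.Empty using (⊥-elim)
open import Data.Product using (∃; _,_; _×_; proj₁; proj₂)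
open import Data.Maybe using (just; nothing)
import Data.Maybe as Maybe
open import Data.Maybe.Relation.Binary.Pointwise using (Pointwise)
open import Function using (_∘_)
open import Relation.Binary.PropositionalEquality
  using (_≡_; _≢_; refl; sym; trans; cong; subst; subst₂)
open import Relation.Binary.PropositionalEquality.Properties using (subst-injective)
open import Relation.Nullary using (¬_; yes; no)

private
  variable
    X Y : Set

seq-now-stable : (d : Delay X) {x : X} → seq d 0 ≡ just x → ∀ k → seq d k ≡ just x
seq-now-stable d e zero    = e
seq-now-stable d e (suc k) = mono d k _ (seq-now-stable d e k)

seq-mapD : (f : X → Y) (d : Delay X) → ∀ k → seq (mapD f d) k ≡ Maybe.map f (seq d k)
seq-mapD f d zero with seq d zero
... | just x  = refl
... | nothing = refl
seq-mapD f d (suc k) with seq d zero in e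
... | just x rewrite seq-now-stable d e (suc k) = refl
... | nothing = seq-mapD f (delay (λ n → seq d (suc n)) (λ n → mono d (suc n))) k

seq-μD-step-now-later : (dd : Delay (Delay X)) (e : Delay X)
  → seq dd 0 ≡ nothing → seq dd 1 ≡ just e → seq e 0 ≡ nothing
  → seq (μD dd) 1 ≡ nothing
seq-μD-step-now-later dd e dd₀ dd₁ e₀ with seq dd 0 | dd₀
... | nothing | refl with seq dd 1 | dd₁
...   | just .e | refl with seq e 0 | e₀
...     | nothing | refl = refl

allNow≡nothing : ∀ n (xs : Fin n → Delay X) i → seq (xs i) 0 ≡ nothing → allNow n xs ≡ nothing
allNow≡nothing (suc n) xs zero    e with seq (xs zero) zero
... | nothing = refl
allNow≡nothing (suc n) xs (suc i) e with seq (xs zero) zero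
... | nothing = refl
... | just _ rewrite allNow≡nothing n (xs ∘ suc) i e = refl

allNow≡just : ∀ n (xs : Fin n → Delay X) (v : Fin n → X)
  → (∀ i → seq (xs i) 0 ≡ just (v i))
  → ∃ λ as → allNow n xs ≡ just as × (∀ i → as i ≡ v i)
allNow≡just zero    xs v now-v = (λ ()) , refl , λ ()
allNow≡just (suc n) xs v now-v
  with allNow≡just n (xs ∘ suc) (v ∘ suc) (now-v ∘ suc)
... | as , e , as≗v with seq (xs zero) zero | now-v zero
...   | just _ | refl rewrite e = _ , refl , λ { zero → refl ; (suc i) → as≗v i }

module _ (n : ℕ) (g : (Fin n → X) → X) where

  seq-par-zero : (xs : Fin n → Delay X)
    → allNow n xs ≡ nothing → seq (par n g xs) 0 ≡ nothing
  seq-par-zero xs e with allNow n xs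
  ... | nothing = refl

  seq-par-suc : (xs : Fin n → Delay X) → allNow n xs ≡ nothing
    → ∀ k → seq (par n g xs) (suc k) ≡ seq (par n g (strip ∘ xs)) k
  seq-par-suc xs e k with allNow n xs
  ... | nothing = refl

  seq-par-allNow : (xs : Fin n → Delay X) {as : Fin n → X}
    → allNow n xs ≡ just as → ∀ k → seq (par n g xs) k ≡ just (g as)
  seq-par-allNow xs e zero    rewrite e = refl
  seq-par-allNow xs e (suc k) rewrite e = refl

  par-finishes-after-strip : (xs : Fin n → Delay X) → ∀ i → seq (xs i) 0 ≡ nothing
    → (v : Fin n → X) → (∀ j → seq (strip (xs j)) 0 ≡ just (v j))
    → ∃ λ as → seq (par n g xs) 1 ≡ just (g as) × (∀ j → as j ≡ v j)
  par-finishes-after-strip xs i later v strip-now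
    with allNow≡just n (strip ∘ xs) v strip-now
  ... | as , stripped-now , as≗v =
    as , trans (seq-par-suc xs (allNow≡nothing n xs i later) 0)
               (seq-par-allNow (strip ∘ xs) stripped-now 0) , as≗v

module Counterexample (Th : Theory) (f : Signature.Op (Theory.sig Th))
                      (i j : Fin (Signature.ar (Theory.sig Th) f)) (i≢j : i ≢ j) where
  open Theory Th
  open Signature sig

  a b : Delay (Delay ⊤)
  a = now (step (now tt))
  b = step (now (now tt))

  arg : Fin (ar f) → Delay (Delay ⊤)
  arg k with k ≟ i
  ... | yes _ = a
  ... | no _  = b

  arg-j : arg j ≡ b
  arg-j with j ≟ i
  ... | yes j≡i = ⊥-elim (i≢j (sym j≡i))
  ... | no _    = refl

  t : Term sig (Delay (Delay ⊤))
  t = op f (var ∘ arg)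

  joined-args : Fin (ar f) → Delay (Term sig ⊤)
  joined-args k = mapD var (μD (arg k))

  joined-args-later : ∀ k → seq (joined-args k) 0 ≡ nothing
  joined-args-later k with k ≟ i
  ... | yes _ = refl
  ... | no _  = refl

  joined-args-strip-now : ∀ k → seq (strip (joined-args k)) 0 ≡ just (var tt)
  joined-args-strip-now k with k ≟ i
  ... | yes _ = refl
  ... | no _  = refl

  lhs-finishes-at-one : ∃ λ u → seq (ζ Th (mapT μD t)) 1 ≡ just u
  lhs-finishes-at-one
    with par-finishes-after-strip (ar f) (op f) joined-args i (joined-args-later i)
                                  (λ _ → var tt) joined-args-strip-now
  ... | _ , lhs₁ , _ = _ , lhs₁

  inner-args : Fin (ar f) → Delay (Term sig (Delay ⊤))
  inner-args k = mapD var (arg k)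

  inner-args-later : seq (inner-args j) 0 ≡ nothing
  inner-args-later = cong (λ d → seq (mapD var d) 0) arg-j

  inner-values : Fin (ar f) → Term sig (Delay ⊤)
  inner-values k with k ≟ i
  ... | yes _ = var (step (now tt))
  ... | no _  = var (now tt)

  inner-args-strip-now : ∀ k → seq (strip (inner-args k)) 0 ≡ just (inner-values k)
  inner-args-strip-now k with k ≟ i
  ... | yes _ = refl
  ... | no _  = refl

  rhs-unfinished-at-one : seq (μD (mapD (ζ Th) (ζ Th t))) 1 ≡ nothing
  rhs-unfinished-at-one
    with par-finishes-after-strip (ar f) (op f) inner-args j inner-args-later
                                  inner-values inner-args-strip-now
  ... | as , outer₁ , as≗v =
    seq-μD-step-now-later (mapD (ζ Th) outer) (ζ Th (op f as)) dd₀ dd₁ inner₀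
    where
    outer = par (ar f) (op f) inner-args
    dd₀ : seq (mapD (ζ Th) outer) 0 ≡ nothing
    dd₀ = trans (seq-mapD (ζ Th) outer 0)
                (cong (Maybe.map (ζ Th)) (seq-par-zero (ar f) (op f) inner-args
                  (allNow≡nothing (ar f) inner-args j inner-args-later)))
    dd₁ : seq (mapD (ζ Th) outer) 1 ≡ just (ζ Th (op f as))
    dd₁ = trans (seq-mapD (ζ Th) outer 1) (cong (Maybe.map (ζ Th)) outer₁)
    vᵢ-later : seq (ζ Th (inner-values i)) 0 ≡ nothing
    vᵢ-later with i ≟ i
    ... | yes _  = refl
    ... | no i≢i = ⊥-elim (i≢i refl)
    inner₀ : seq (ζ Th (op f as)) 0 ≡ nothing
    inner₀ = seq-par-zero (ar f) (op f) (ζ Th ∘ as)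
               (allNow≡nothing (ar f) (ζ Th ∘ as) i
                 (trans (cong (λ u → seq (ζ Th u) 0) (as≗v i)) vᵢ-later))

  multiplication-law-fails :
    ¬ Bisim (Th ⊢_≈_) (ζ Th (mapT μD t)) (μD (mapD (ζ Th) (ζ Th t)))
  multiplication-law-fails bisim
    with subst₂ (Pointwise (Th ⊢_≈_)) (proj₂ lhs-finishes-at-one) rhs-unfinished-at-one (bisim 1)
  ... | ()

theorem5p5 : (Th : Theory) (◇ : Signature.Op (Theory.sig Th))
    → Signature.ar (Theory.sig Th) ◇ ≡ 2
    → ¬ (∀ (X : Set) (t : Term (Theory.sig Th) (Delay (Delay X)))
    → Bisim (Th ⊢_≈_) (ζ Th (mapT μD t)) (μD (mapD (ζ Th) (ζ Th t))))
theorem5p5 Th ◇ ar≡2 law = multiplication-law-fails (law ⊤ t)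
  where
  i j : Fin (Signature.ar (Theory.sig Th) ◇)
  i = subst Fin (sym ar≡2) zero
  j = subst Fin (sym ar≡2) (suc zero)
  i≢j : i ≢ j
  i≢j i≡j = 0≢1+n (subst-injective (sym ar≡2) i≡j)
  open Counterexample Th ◇ i j i≢j
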